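{- For every partition $\lambda$ into distinct parts, $2\mu_2(\lambda)=\ell(\lambda)+\mathrm{sol}(\lambda)$.
   Context: $\ell(\lambda)$ is the number of parts of $\lambda$. $\mu_2(\lambda)$, the 2-measure of $\lambda$, is the largest size of a subcollection (not necessarily consecutive) of parts of $\lambda$ in which any two chosen parts differ by at least $2$. $\mathrm{sol}(\lambda)$ is the number of sequences of odd length in $\lambda$, where a sequence is a maximal run of parts of $\lambda$ forming consecutive integers. -}

module Defs where

open import Data.Nat using (ℕ; zero; suc; _+_; _*_; _⊔_; _<_; _>_; _≤_; _%_; ∣_-_∣; _≟_; _≤?_)
open import Data.Nat using () renaming (_≡ᵇ_ to _==_)
open import Data.Bool using (if_then_else_)
open import Data.List using (List; []; _∷_; length; map; filter; foldr; _++_)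
open import Data.List.Relation.Unary.All using (All)
open import Data.List.Relation.Unary.AllPairs using (AllPairs; allPairs?)
open import Data.List.Relation.Unary.Linked using (Linked)
open import Relation.Binary.PropositionalEquality using (_≡_)

IsDistinctPartition : List ℕ → Set
IsDistinctPartition ps = All (λ p → 0 < p) ps × Linked _>_ ps
  where open import Data.Product using (_×_)

ℓ : List ℕ → ℕ
ℓ = length

sublists : {A : Set} → List A → List (List A)
sublists [] = [] ∷ []
sublists (x ∷ xs) = map (x ∷_) (sublists xs) ++ sublists xs

Gap2 : List ℕ → Set
Gap2 = AllPairs (λ a b → 2 ≤ ∣ a - b ∣)

maximum : List ℕ → ℕ
maximum = foldr _⊔_ 0

μ₂ : List ℕ → ℕ
μ₂ ps = maximum (map length (filter (allPairs? (λ a b → 2 ≤? ∣ a - b ∣)) (sublists ps)))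

consRun : ℕ → List (List ℕ) → List (List ℕ)
consRun x [] = (x ∷ []) ∷ []
consRun x (r ∷ rs) = (x ∷ r) ∷ rs

runsFrom : ℕ → List ℕ → List (List ℕ)
runsFrom x [] = (x ∷ []) ∷ []
runsFrom x (y ∷ ys) =
  if ∣ x - y ∣ == 1 then consRun x (runsFrom y ys) else (x ∷ []) ∷ runsFrom y ys

sequences : List ℕ → List (List ℕ)
sequences [] = []
sequences (x ∷ xs) = runsFrom x xs

sol : List ℕ → ℕ
sol ps = length (filter (λ r → length r % 2 ≟ 1) (sequences ps))

{-# OPTIONS --safe #-}
module Submission where

-- Scan the parts from the largest down, keeping a part and skipping the next
-- one whenever the two are consecutive integers.  Each skip pairs off two
-- neighbouring parts, at most one of which fits in a subcollection with gaps
-- of at least 2, so the greedy selection is optimal.  Inside a sequence of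
-- length k it keeps ⌈k/2⌉ parts, and 2⌈k/2⌉ = k + [k odd]; summing over the
-- sequences gives 2μ₂ = ℓ + sol.

open import Defs
open import Data.Nat using (ℕ; zero; suc; _+_; _*_; _≤_; _<_; _>_; z≤n; s≤s; ∣_-_∣; _%_; _≟_; _≤?_)
open import Data.Nat using () renaming (_≡ᵇ_ to _==_)
open import Data.Nat.Properties
  using (≤-refl; ≤-trans; ≤-reflexive; ≤-antisym; m≤n+m; m≤n⇒m≤1+n; *-suc; +-suc; ⊔-lub; m≤n⇒m≤n⊔o; m≤n⇒m≤o⊔n)
open import Data.Bool using (true; false; if_then_else_)
open import Data.List using (List; []; _∷_; length; map; filter)
open import Data.List.Properties using (foldr-preservesᵇ; foldr-preservesᵒ)
open import Data.List.Membership.Propositional using (_∈_)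
open import Data.List.Membership.Propositional.Properties
  using (∈-map⁺; ∈-map⁻; ∈-++⁺ˡ; ∈-++⁺ʳ; ∈-++⁻; ∈-filter⁺; ∈-filter⁻)
open import Data.List.Relation.Unary.All as All using (All; _∷_)
open import Data.List.Relation.Unary.Any as Any using (here)
open import Data.List.Relation.Unary.AllPairs as AllPairs using (_∷_; allPairs?)
open import Data.List.Relation.Unary.Linked using (Linked; [-]; _∷_)
open import Data.List.Relation.Unary.Linked.Properties using (Linked⇒AllPairs)
open import Data.List.Relation.Binary.Sublist.Propositional using (_⊆_; []; _∷_; _∷ʳ_)
open import Data.Product using (_,_)
open import Data.Sum using (inj₁; inj₂; [_,_])
open import Relation.Nullary using (proof)
open import Relation.Nullary.Reflects using (Reflects; ofʸ; ofⁿ)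
open import Relation.Binary using (Transitive)
open import Relation.Unary using (Decidable)
open import Relation.Binary.PropositionalEquality using (_≡_; _≢_; refl; cong; module ≡-Reasoning)
open ≡-Reasoning

mutual
  greedy : List ℕ → List ℕ
  greedy []       = []
  greedy (x ∷ xs) = x ∷ greedyAfter x xs

  greedyAfter : ℕ → List ℕ → List ℕ
  greedyAfter x []       = []
  greedyAfter x (y ∷ ys) = if ∣ x - y ∣ == 1 then greedy ys else y ∷ greedyAfter y ys

adjacent? : ∀ x y → Reflects (∣ x - y ∣ ≡ 1) (∣ x - y ∣ == 1)
adjacent? x y = proof (∣ x - y ∣ ≟ 1)

oddRuns : List (List ℕ) → ℕ
oddRuns rs = length (filter (λ r → length r % 2 ≟ 1) rs)

oddRuns-consRun₂ : ∀ x y rs → oddRuns (consRun x (consRun y rs)) ≡ oddRuns rs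
oddRuns-consRun₂ x y []       = refl
-- (2 + n) % 2 reduces to n % 2, so one test decides the parity of both first runs.
oddRuns-consRun₂ x y (r ∷ rs) with length r % 2 == 1
... | true  = refl
... | false = refl

oddRuns-consRun-runsFrom : ∀ x y ys → oddRuns (consRun x (runsFrom y ys)) ≡ sol ys
oddRuns-consRun-runsFrom x y []       = refl
oddRuns-consRun-runsFrom x y (z ∷ zs) with ∣ y - z ∣ == 1
... | true  = oddRuns-consRun₂ x y (runsFrom z zs)
... | false = refl

mutual
  2*length-greedy : ∀ xs → 2 * length (greedy xs) ≡ ℓ xs + sol xs
  2*length-greedy []       = refl
  2*length-greedy (x ∷ xs) = 2*length-greedyAfter x xs

  2*length-greedyAfter : ∀ x xs → 2 * suc (length (greedyAfter x xs)) ≡ suc (length xs) + oddRuns (runsFrom x xs)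
  2*length-greedyAfter x []       = refl
  2*length-greedyAfter x (y ∷ ys) with ∣ x - y ∣ == 1
  ... | true = begin
    2 * suc (length (greedy ys))  ≡⟨ *-suc 2 _ ⟩
    2 + 2 * length (greedy ys)    ≡⟨ cong (2 +_) (2*length-greedy ys) ⟩
    2 + (length ys + sol ys)      ≡⟨ cong (λ s → 2 + (length ys + s)) (oddRuns-consRun-runsFrom x y ys) ⟨
    2 + (length ys + oddRuns (consRun x (runsFrom y ys)))  ∎
  ... | false = begin
    2 * suc (suc (length (greedyAfter y ys)))  ≡⟨ *-suc 2 (suc (length (greedyAfter y ys))) ⟩
    2 + 2 * suc (length (greedyAfter y ys))    ≡⟨ cong (2 +_) (2*length-greedyAfter y ys) ⟩
    2 + (suc (length ys) + oddRuns (runsFrom y ys))  ≡⟨ cong suc (+-suc (suc (length ys)) _) ⟨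
    2 + length ys + suc (oddRuns (runsFrom y ys))    ∎

mutual
  greedy-⊆ : ∀ xs → greedy xs ⊆ xs
  greedy-⊆ []       = []
  greedy-⊆ (x ∷ xs) = refl ∷ greedyAfter-⊆ x xs

  greedyAfter-⊆ : ∀ x xs → greedyAfter x xs ⊆ xs
  greedyAfter-⊆ x []       = []
  greedyAfter-⊆ x (y ∷ ys) with ∣ x - y ∣ == 1
  ... | true  = y ∷ʳ greedy-⊆ ys
  ... | false = refl ∷ greedyAfter-⊆ y ys

mutual
  length-≤-greedy : ∀ {xs ys} → xs ⊆ ys → Gap2 xs → length xs ≤ length (greedy ys)
  length-≤-greedy []                      _   = z≤n
  length-≤-greedy {ys = y ∷ ys} xs⊆y∷ys gap = length-≤-greedyAfter y ys xs⊆y∷ys gap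

  length-≤-greedyAfter : ∀ {xs} x ys → xs ⊆ x ∷ ys → Gap2 xs → length xs ≤ suc (length (greedyAfter x ys))
  length-≤-greedyAfter x []       (refl ∷ []) _ = ≤-refl
  length-≤-greedyAfter x []       (_ ∷ʳ [])   _ = z≤n
  length-≤-greedyAfter x (y ∷ ys) sub gap with ∣ x - y ∣ == 1 | adjacent? x y | sub | gap
  ... | true  | ofʸ adj | refl ∷ refl ∷ _ | (2≤∣x-y∣ ∷ _) ∷ _
        with s≤s () ← ≤-trans 2≤∣x-y∣ (≤-reflexive adj)
  ... | true  | _ | refl ∷ _ ∷ʳ sub′  | _ ∷ gap′ = s≤s (length-≤-greedy sub′ gap′)
  ... | true  | _ | _ ∷ʳ refl ∷ sub′  | _ ∷ gap′ = s≤s (length-≤-greedy sub′ gap′)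
  ... | true  | _ | _ ∷ʳ _ ∷ʳ sub′    | gap′     = m≤n⇒m≤1+n (length-≤-greedy sub′ gap′)
  ... | false | _ | refl ∷ sub′       | _ ∷ gap′ = s≤s (length-≤-greedyAfter y ys sub′ gap′)
  ... | false | _ | _ ∷ʳ sub′         | gap′     = m≤n⇒m≤1+n (length-≤-greedyAfter y ys sub′ gap′)

_≫_ : ℕ → ℕ → Set
m ≫ n = 2 + n ≤ m

≫-trans : Transitive _≫_
≫-trans {i} {j} i≫j j≫k = ≤-trans j≫k (≤-trans (m≤n+m j 2) i≫j)

<-<⇒≫ : ∀ {k m n} → k < m → m < n → n ≫ k
<-<⇒≫ k<m m<n = ≤-trans (s≤s k<m) m<n

≢1⇒≫ : ∀ {m n} → n < m → ∣ m - n ∣ ≢ 1 → m ≫ n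
≢1⇒≫ {suc zero}    {zero}  _         ∣m-n∣≢1 with () ← ∣m-n∣≢1 refl
≢1⇒≫ {suc (suc m)} {zero}  _         _       = s≤s (s≤s z≤n)
≢1⇒≫ {suc m}       {suc n} (s≤s n<m) ∣m-n∣≢1 = s≤s (≢1⇒≫ n<m ∣m-n∣≢1)

≫⇒2≤∣-∣ : ∀ {m n} → m ≫ n → 2 ≤ ∣ m - n ∣
≫⇒2≤∣-∣ {suc (suc m)} {zero}  _         = s≤s (s≤s z≤n)
≫⇒2≤∣-∣ {suc m}       {suc n} (s≤s m≫n) = ≫⇒2≤∣-∣ m≫n

greedyAfter-≫ : ∀ {x xs} → Linked _>_ (x ∷ xs) → Linked _≫_ (x ∷ greedyAfter x xs)
greedyAfter-≫ [-] = [-]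
greedyAfter-≫ {x} {y ∷ ys} (y<x ∷ y∷ys↓) with ∣ x - y ∣ == 1 | adjacent? x y | y∷ys↓
... | true  | _        | [-]             = [-]
... | true  | _        | z<y ∷ z∷zs↓     = <-<⇒≫ z<y y<x ∷ greedyAfter-≫ z∷zs↓
... | false | ofⁿ ¬adj | _               = ≢1⇒≫ y<x ¬adj ∷ greedyAfter-≫ y∷ys↓

greedy-Gap2 : ∀ {xs} → Linked _>_ xs → Gap2 (greedy xs)
greedy-Gap2 {[]}    _   = AllPairs.[]
greedy-Gap2 {_ ∷ _} xs↓ = AllPairs.map ≫⇒2≤∣-∣ (Linked⇒AllPairs ≫-trans (greedyAfter-≫ xs↓))

∈-sublists⁺ : ∀ {A : Set} {xs ys : List A} → xs ⊆ ys → xs ∈ sublists ys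
∈-sublists⁺ []                       = here refl
∈-sublists⁺ (_∷_ {x = x} refl xs⊆ys) = ∈-++⁺ˡ (∈-map⁺ (x ∷_) (∈-sublists⁺ xs⊆ys))
∈-sublists⁺ (_∷ʳ_ {ys = ys} y xs⊆ys) = ∈-++⁺ʳ (map (y ∷_) (sublists ys)) (∈-sublists⁺ xs⊆ys)

∈-sublists⁻ : ∀ {A : Set} {xs} (ys : List A) → xs ∈ sublists ys → xs ⊆ ys
∈-sublists⁻ []       (here refl) = []
∈-sublists⁻ (y ∷ ys) xs∈ with ∈-++⁻ (map (y ∷_) (sublists ys)) xs∈
... | inj₁ xs∈kept with _ , xs′∈ , refl ← ∈-map⁻ (y ∷_) xs∈kept = refl ∷ ∈-sublists⁻ ys xs′∈
... | inj₂ xs∈skipped = y ∷ʳ ∈-sublists⁻ ys xs∈skipped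

maximum-lub : ∀ {m ns} → All (_≤ m) ns → maximum ns ≤ m
maximum-lub = foldr-preservesᵇ ⊔-lub z≤n

∈⇒≤maximum : ∀ {n ns} → n ∈ ns → n ≤ maximum ns
∈⇒≤maximum {ns = ns} n∈ns =
  foldr-preservesᵒ (λ a b → [ m≤n⇒m≤n⊔o b , m≤n⇒m≤o⊔n a ]) 0 ns (inj₂ (Any.map ≤-reflexive n∈ns))

Gap2? : Decidable Gap2
Gap2? = allPairs? (λ a b → 2 ≤? ∣ a - b ∣)

μ₂≤length-greedy : ∀ xs → μ₂ xs ≤ length (greedy xs)
μ₂≤length-greedy xs = maximum-lub (All.tabulate bounded)
  where
  bounded : ∀ {n} → n ∈ map length (filter Gap2? (sublists xs)) → n ≤ length (greedy xs)
  bounded n∈ with ys , ys∈ , refl ← ∈-map⁻ length n∈ with ys∈sublists , gap ← ∈-filter⁻ Gap2? ys∈ =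
    length-≤-greedy (∈-sublists⁻ xs ys∈sublists) gap

length-greedy≤μ₂ : ∀ {xs} → Linked _>_ xs → length (greedy xs) ≤ μ₂ xs
length-greedy≤μ₂ {xs} xs↓ =
  ∈⇒≤maximum (∈-map⁺ length (∈-filter⁺ Gap2? (∈-sublists⁺ (greedy-⊆ xs)) (greedy-Gap2 xs↓)))

μ₂≡length-greedy : ∀ {xs} → Linked _>_ xs → μ₂ xs ≡ length (greedy xs)
μ₂≡length-greedy {xs} xs↓ = ≤-antisym (μ₂≤length-greedy xs) (length-greedy≤μ₂ xs↓)

mainTheorem4 : (lam : List ℕ) → IsDistinctPartition lam →
    2 * μ₂ lam ≡ ℓ lam + sol lam
mainTheorem4 lam (_ , lam↓) = begin
  2 * μ₂ lam               ≡⟨ cong (2 *_) (μ₂≡length-greedy lam↓) ⟩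
  2 * length (greedy lam)  ≡⟨ 2*length-greedy lam ⟩
  ℓ lam + sol lam          ∎
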